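{- $\mathbb{V}(\mathsf{NBCA})=\mathbb{V}(\mathsf{BCA})$, i.e. $\mathsf{NBCA}$ and $\mathsf{BCA}$ generate the same variety.
   Context: Let $\mathbf{WK}^e$ be the three-element algebra on $\{0,\tfrac12,1\}$ with $\neg 1=0,\neg\tfrac12=\tfrac12,\neg0=1$; $\vee,\wedge$ equal to $\tfrac12$ when one argument is $\tfrac12$ and Boolean otherwise; $J_0:0\mapsto1,\tfrac12\mapsto0,1\mapsto0$; $J_1:\tfrac12\mapsto1$, $0,1\mapsto 0$; $J_2:1\mapsto1$, $0,\tfrac12\mapsto0$. $\mathsf{BCA}=ISP(\mathbf{WK}^e)$ is the quasivariety of Bochvar algebras; $\mathsf{NBCA}$ is its subquasivariety axiomatized by adding $J_1x\approx1\Rightarrow y\approx1$. $\mathbb{V}(\mathsf{K})=HSP(\mathsf{K})$. -}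

module Defs where

open import Level using (Level; Lift; lift; lower) renaming (suc to lsuc)
open import Relation.Binary using (Rel; IsEquivalence)
open import Relation.Binary.PropositionalEquality using (_≡_)
open import Data.Product using (Σ; ∃; _×_; _,_)

-- Algebras in the language of Bochvar algebras:
-- type (2,2,1,1,1,1,0,0): ∨, ∧, ¬, J₀, J₁, J₂, 0, 1.
-- Carriers are setoids (needed for homomorphic images / quotients).

record Alg (ℓ : Level) : Set (lsuc ℓ) where
  infixr 6 _∨_
  infixr 7 _∧_
  infix 4 _≈_
  field
    Carrier : Set ℓ
    _≈_     : Rel Carrier ℓ
    isEquiv : IsEquivalence _≈_
    _∨_ _∧_ : Carrier → Carrier → Carrier
    neg J₀ J₁ J₂ : Carrier → Carrier
    𝟎 𝟏     : Carrier
    ∨-cong  : ∀ {x x' y y'} → x ≈ x' → y ≈ y' → (x ∨ y) ≈ (x' ∨ y')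
    ∧-cong  : ∀ {x x' y y'} → x ≈ x' → y ≈ y' → (x ∧ y) ≈ (x' ∧ y')
    neg-cong : ∀ {x x'} → x ≈ x' → neg x ≈ neg x'
    J₀-cong : ∀ {x x'} → x ≈ x' → J₀ x ≈ J₀ x'
    J₁-cong : ∀ {x x'} → x ≈ x' → J₁ x ≈ J₁ x'
    J₂-cong : ∀ {x x'} → x ≈ x' → J₂ x ≈ J₂ x'

open Alg

record Hom {ℓ : Level} (A B : Alg ℓ) : Set ℓ where
  field
    map    : Carrier A → Carrier B
    cong   : ∀ {x y} → _≈_ A x y → _≈_ B (map x) (map y)
    pres-∨ : ∀ x y → _≈_ B (map (_∨_ A x y)) (_∨_ B (map x) (map y))
    pres-∧ : ∀ x y → _≈_ B (map (_∧_ A x y)) (_∧_ B (map x) (map y))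
    pres-neg : ∀ x → _≈_ B (map (neg A x)) (neg B (map x))
    pres-J₀ : ∀ x → _≈_ B (map (J₀ A x)) (J₀ B (map x))
    pres-J₁ : ∀ x → _≈_ B (map (J₁ A x)) (J₁ B (map x))
    pres-J₂ : ∀ x → _≈_ B (map (J₂ A x)) (J₂ B (map x))
    pres-𝟎 : _≈_ B (map (𝟎 A)) (𝟎 B)
    pres-𝟏 : _≈_ B (map (𝟏 A)) (𝟏 B)

open Hom

Embedding : {ℓ : Level} → Alg ℓ → Alg ℓ → Set ℓ
Embedding A B = Σ (Hom A B) λ h → ∀ x y → _≈_ B (map h x) (map h y) → _≈_ A x y

Epi : {ℓ : Level} → Alg ℓ → Alg ℓ → Set ℓ
Epi A B = Σ (Hom A B) λ h → ∀ b → ∃ λ a → _≈_ B (map h a) b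

Π-Alg : {ℓ : Level} (I : Set ℓ) → (I → Alg ℓ) → Alg ℓ
Π-Alg I A = record
  { Carrier = (i : I) → Carrier (A i)
  ; _≈_ = λ f g → ∀ i → _≈_ (A i) (f i) (g i)
  ; isEquiv = record
      { refl = λ i → IsEquivalence.refl (isEquiv (A i))
      ; sym = λ p i → IsEquivalence.sym (isEquiv (A i)) (p i)
      ; trans = λ p q i → IsEquivalence.trans (isEquiv (A i)) (p i) (q i) }
  ; _∨_ = λ f g i → _∨_ (A i) (f i) (g i)
  ; _∧_ = λ f g i → _∧_ (A i) (f i) (g i)
  ; neg = λ f i → neg (A i) (f i)
  ; J₀ = λ f i → J₀ (A i) (f i)
  ; J₁ = λ f i → J₁ (A i) (f i)
  ; J₂ = λ f i → J₂ (A i) (f i)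
  ; 𝟎 = λ i → 𝟎 (A i)
  ; 𝟏 = λ i → 𝟏 (A i)
  ; ∨-cong = λ p q i → ∨-cong (A i) (p i) (q i)
  ; ∧-cong = λ p q i → ∧-cong (A i) (p i) (q i)
  ; neg-cong = λ p i → neg-cong (A i) (p i)
  ; J₀-cong = λ p i → J₀-cong (A i) (p i)
  ; J₁-cong = λ p i → J₁-cong (A i) (p i)
  ; J₂-cong = λ p i → J₂-cong (A i) (p i)
  }

data Three : Set where
  ₀ ½ ₁ : Three

¬₃ : Three → Three
¬₃ ₀ = ₁
¬₃ ½ = ½
¬₃ ₁ = ₀

_∨₃_ : Three → Three → Three
½ ∨₃ _ = ½
_ ∨₃ ½ = ½
₀ ∨₃ ₀ = ₀
₀ ∨₃ ₁ = ₁
₁ ∨₃ ₀ = ₁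
₁ ∨₃ ₁ = ₁

_∧₃_ : Three → Three → Three
½ ∧₃ _ = ½
_ ∧₃ ½ = ½
₀ ∧₃ ₀ = ₀
₀ ∧₃ ₁ = ₀
₁ ∧₃ ₀ = ₀
₁ ∧₃ ₁ = ₁

J₀₃ J₁₃ J₂₃ : Three → Three
J₀₃ ₀ = ₁
J₀₃ ½ = ₀
J₀₃ ₁ = ₀
J₁₃ ₀ = ₀
J₁₃ ½ = ₁
J₁₃ ₁ = ₀
J₂₃ ₀ = ₀
J₂₃ ½ = ₀
J₂₃ ₁ = ₁

open import Relation.Binary.PropositionalEquality as P using ()

WKe : (ℓ : Level) → Alg ℓ
WKe ℓ = record
  { Carrier = Lift ℓ Three
  ; _≈_ = λ x y → Lift ℓ (lower x ≡ lower y)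
  ; isEquiv = record
      { refl = lift P.refl
      ; sym = λ p → lift (P.sym (lower p))
      ; trans = λ p q → lift (P.trans (lower p) (lower q)) }
  ; _∨_ = λ x y → lift (lower x ∨₃ lower y)
  ; _∧_ = λ x y → lift (lower x ∧₃ lower y)
  ; neg = λ x → lift (¬₃ (lower x))
  ; J₀ = λ x → lift (J₀₃ (lower x))
  ; J₁ = λ x → lift (J₁₃ (lower x))
  ; J₂ = λ x → lift (J₂₃ (lower x))
  ; 𝟎 = lift ₀
  ; 𝟏 = lift ₁
  ; ∨-cong = λ p q → lift (P.cong₂ _∨₃_ (lower p) (lower q))
  ; ∧-cong = λ p q → lift (P.cong₂ _∧₃_ (lower p) (lower q))
  ; neg-cong = λ p → lift (P.cong ¬₃ (lower p))
  ; J₀-cong = λ p → lift (P.cong J₀₃ (lower p))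
  ; J₁-cong = λ p → lift (P.cong J₁₃ (lower p))
  ; J₂-cong = λ p → lift (P.cong J₂₃ (lower p))
  }

-- BCA = ISP(WK^e): algebras embeddable into a direct power of WK^e
BCA : {ℓ : Level} → Alg ℓ → Set (lsuc ℓ)
BCA {ℓ} A = Σ (Set ℓ) λ I → Embedding A (Π-Alg I (λ _ → WKe ℓ))

NBCA : {ℓ : Level} → Alg ℓ → Set (lsuc ℓ)
NBCA A = BCA A × (∀ x y → _≈_ A (J₁ A x) (𝟏 A) → _≈_ A y (𝟏 A))

𝕍 : {ℓ : Level} → (Alg ℓ → Set (lsuc ℓ)) → Alg ℓ → Set (lsuc ℓ)
𝕍 {ℓ} K B =
  Σ (Set ℓ) λ I → Σ (I → Alg ℓ) λ A → (∀ i → K (A i)) ×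
    Σ (Alg ℓ) λ S → Embedding S (Π-Alg I A) × Epi S B

-- Every Bochvar algebra A is the image of A × 𝟚 under the first projection,
-- where 𝟚 is the Boolean subalgebra {0,1} of WK^e.  Since J₁ never takes the
-- value 1 on 𝟚, it never does on A × 𝟚 either, so A × 𝟚 satisfies the
-- quasi-identity J₁ x ≈ 1 ⇒ y ≈ 1 vacuously and lies in NBCA.  Applying this
-- to the factors of a product shows that every member of 𝕍(BCA) is already a
-- homomorphic image of a subalgebra of a product of members of NBCA.
module Submission where

open import Defs
open import Level using (Level; Lift; lift; lower)
open import Function using (_∘_; id; const)
open import Data.Bool using (Bool; true; false; not) renaming (_∨_ to _or_; _∧_ to _and_)
open import Data.Empty using (⊥-elim)
open import Data.Product using (_×_; _,_; proj₁; proj₂; <_,_>; zip′) renaming (map to map-×)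
open import Data.Product.Relation.Binary.Pointwise.NonDependent using (Pointwise; ×-isEquivalence)
open import Data.Sum using (_⊎_; inj₁; inj₂; [_,_])
open import Data.Unit.Polymorphic using (⊤; tt)
open import Relation.Binary using (IsEquivalence)
open import Relation.Binary.PropositionalEquality as P using (_≡_)
open import Relation.Nullary using (¬_)

open Alg
open Hom

private
  variable
    ℓ : Level
    I : Set ℓ
    A B C S : Alg ℓ

infixr 9 _∘ₕ_

_∘ₕ_ : Hom B C → Hom A B → Hom A C
_∘ₕ_ {C = C} g f = record
  { map = map g ∘ map f
  ; cong = cong g ∘ cong f
  ; pres-∨ = λ x y → trans (cong g (pres-∨ f x y)) (pres-∨ g _ _)
  ; pres-∧ = λ x y → trans (cong g (pres-∧ f x y)) (pres-∧ g _ _)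
  ; pres-neg = λ x → trans (cong g (pres-neg f x)) (pres-neg g _)
  ; pres-J₀ = λ x → trans (cong g (pres-J₀ f x)) (pres-J₀ g _)
  ; pres-J₁ = λ x → trans (cong g (pres-J₁ f x)) (pres-J₁ g _)
  ; pres-J₂ = λ x → trans (cong g (pres-J₂ f x)) (pres-J₂ g _)
  ; pres-𝟎 = trans (cong g (pres-𝟎 f)) (pres-𝟎 g)
  ; pres-𝟏 = trans (cong g (pres-𝟏 f)) (pres-𝟏 g)
  }
  where open IsEquivalence (isEquiv C)

π : {A : I → Alg ℓ} (i : I) → Hom (Π-Alg I A) (A i)
π {A = A} i = record
  { map = λ f → f i
  ; cong = λ p → p i
  ; pres-∨ = λ _ _ → refl
  ; pres-∧ = λ _ _ → refl
  ; pres-neg = λ _ → refl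
  ; pres-J₀ = λ _ → refl
  ; pres-J₁ = λ _ → refl
  ; pres-J₂ = λ _ → refl
  ; pres-𝟎 = refl
  ; pres-𝟏 = refl
  }
  where open IsEquivalence (isEquiv (A i))

Π-hom : {A : I → Alg ℓ} → ((i : I) → Hom C (A i)) → Hom C (Π-Alg I A)
Π-hom fs = record
  { map = λ x i → map (fs i) x
  ; cong = λ p i → cong (fs i) p
  ; pres-∨ = λ x y i → pres-∨ (fs i) x y
  ; pres-∧ = λ x y i → pres-∧ (fs i) x y
  ; pres-neg = λ x i → pres-neg (fs i) x
  ; pres-J₀ = λ x i → pres-J₀ (fs i) x
  ; pres-J₁ = λ x i → pres-J₁ (fs i) x
  ; pres-J₂ = λ x i → pres-J₂ (fs i) x
  ; pres-𝟎 = λ i → pres-𝟎 (fs i)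
  ; pres-𝟏 = λ i → pres-𝟏 (fs i)
  }

infixr 2 _×ₐ_

_×ₐ_ : Alg ℓ → Alg ℓ → Alg ℓ
A ×ₐ B = record
  { Carrier = Carrier A × Carrier B
  ; _≈_ = Pointwise (_≈_ A) (_≈_ B)
  ; isEquiv = ×-isEquivalence (isEquiv A) (isEquiv B)
  ; _∨_ = zip′ (_∨_ A) (_∨_ B)
  ; _∧_ = zip′ (_∧_ A) (_∧_ B)
  ; neg = map-× (neg A) (neg B)
  ; J₀ = map-× (J₀ A) (J₀ B)
  ; J₁ = map-× (J₁ A) (J₁ B)
  ; J₂ = map-× (J₂ A) (J₂ B)
  ; 𝟎 = 𝟎 A , 𝟎 B
  ; 𝟏 = 𝟏 A , 𝟏 B
  ; ∨-cong = λ p q → ∨-cong A (proj₁ p) (proj₁ q) , ∨-cong B (proj₂ p) (proj₂ q)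
  ; ∧-cong = λ p q → ∧-cong A (proj₁ p) (proj₁ q) , ∧-cong B (proj₂ p) (proj₂ q)
  ; neg-cong = map-× (neg-cong A) (neg-cong B)
  ; J₀-cong = map-× (J₀-cong A) (J₀-cong B)
  ; J₁-cong = map-× (J₁-cong A) (J₁-cong B)
  ; J₂-cong = map-× (J₂-cong A) (J₂-cong B)
  }

proj₁ₕ : Hom (A ×ₐ B) A
proj₁ₕ {A = A} = record
  { map = proj₁
  ; cong = proj₁
  ; pres-∨ = λ _ _ → refl
  ; pres-∧ = λ _ _ → refl
  ; pres-neg = λ _ → refl
  ; pres-J₀ = λ _ → refl
  ; pres-J₁ = λ _ → refl
  ; pres-J₂ = λ _ → refl
  ; pres-𝟎 = refl
  ; pres-𝟏 = refl
  }
  where open IsEquivalence (isEquiv A)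

proj₂ₕ : Hom (A ×ₐ B) B
proj₂ₕ {B = B} = record
  { map = proj₂
  ; cong = proj₂
  ; pres-∨ = λ _ _ → refl
  ; pres-∧ = λ _ _ → refl
  ; pres-neg = λ _ → refl
  ; pres-J₀ = λ _ → refl
  ; pres-J₁ = λ _ → refl
  ; pres-J₂ = λ _ → refl
  ; pres-𝟎 = refl
  ; pres-𝟏 = refl
  }
  where open IsEquivalence (isEquiv B)

⟨_,_⟩ₕ : Hom C A → Hom C B → Hom C (A ×ₐ B)
⟨ f , g ⟩ₕ = record
  { map = < map f , map g >
  ; cong = < cong f , cong g >
  ; pres-∨ = λ x y → pres-∨ f x y , pres-∨ g x y
  ; pres-∧ = λ x y → pres-∧ f x y , pres-∧ g x y
  ; pres-neg = < pres-neg f , pres-neg g >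
  ; pres-J₀ = < pres-J₀ f , pres-J₀ g >
  ; pres-J₁ = < pres-J₁ f , pres-J₁ g >
  ; pres-J₂ = < pres-J₂ f , pres-J₂ g >
  ; pres-𝟎 = pres-𝟎 f , pres-𝟎 g
  ; pres-𝟏 = pres-𝟏 f , pres-𝟏 g
  }

𝟚 : Alg ℓ
𝟚 {ℓ} = record
  { Carrier = Lift ℓ Bool
  ; _≈_ = _≡_
  ; isEquiv = P.isEquivalence
  ; _∨_ = λ x y → lift (lower x or lower y)
  ; _∧_ = λ x y → lift (lower x and lower y)
  ; neg = lift ∘ not ∘ lower
  ; J₀ = lift ∘ not ∘ lower
  ; J₁ = const (lift false)
  ; J₂ = id
  ; 𝟎 = lift false
  ; 𝟏 = lift true
  ; ∨-cong = λ { P.refl P.refl → P.refl }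
  ; ∧-cong = λ { P.refl P.refl → P.refl }
  ; neg-cong = λ { P.refl → P.refl }
  ; J₀-cong = λ { P.refl → P.refl }
  ; J₁-cong = λ { P.refl → P.refl }
  ; J₂-cong = id
  }

toThree : Bool → Three
toThree false = ₀
toThree true = ₁

toThree-injective : ∀ {b b'} → toThree b ≡ toThree b' → b ≡ b'
toThree-injective {false} {false} _ = P.refl
toThree-injective {true} {true} _ = P.refl

toThree-or : ∀ b b' → toThree (b or b') ≡ toThree b ∨₃ toThree b'
toThree-or false false = P.refl
toThree-or false true = P.refl
toThree-or true false = P.refl
toThree-or true true = P.refl

toThree-and : ∀ b b' → toThree (b and b') ≡ toThree b ∧₃ toThree b'
toThree-and false false = P.refl
toThree-and false true = P.refl
toThree-and true false = P.refl
toThree-and true true = P.refl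

𝟚→WKe : Hom 𝟚 (WKe ℓ)
𝟚→WKe = record
  { map = lift ∘ toThree ∘ lower
  ; cong = λ { P.refl → lift P.refl }
  ; pres-∨ = λ x y → lift (toThree-or (lower x) (lower y))
  ; pres-∧ = λ x y → lift (toThree-and (lower x) (lower y))
  ; pres-neg = λ { (lift false) → lift P.refl ; (lift true) → lift P.refl }
  ; pres-J₀ = λ { (lift false) → lift P.refl ; (lift true) → lift P.refl }
  ; pres-J₁ = λ { (lift false) → lift P.refl ; (lift true) → lift P.refl }
  ; pres-J₂ = λ { (lift false) → lift P.refl ; (lift true) → lift P.refl }
  ; pres-𝟎 = lift P.refl
  ; pres-𝟏 = lift P.refl
  }

BCA-𝟚 : BCA {ℓ} 𝟚
BCA-𝟚 = ⊤ , Π-hom (const 𝟚→WKe) , λ _ _ p → P.cong lift (toThree-injective (lower (p tt)))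

BCA-× : BCA A → BCA B → BCA (A ×ₐ B)
BCA-× {ℓ} (I , h , h-inj) (J , k , k-inj) =
  (I ⊎ J) ,
  Π-hom {A = const (WKe ℓ)}
        [ (λ i → π i ∘ₕ h ∘ₕ proj₁ₕ) , (λ j → π j ∘ₕ k ∘ₕ proj₂ₕ) ] ,
  λ x y p → h-inj _ _ (p ∘ inj₁) , k-inj _ _ (p ∘ inj₂)

J₁-never-𝟏 : Alg ℓ → Set ℓ
J₁-never-𝟏 A = ∀ x → ¬ _≈_ A (J₁ A x) (𝟏 A)

J₁-never-𝟏-𝟚 : J₁-never-𝟏 {ℓ} 𝟚
J₁-never-𝟏-𝟚 _ ()

J₁-never-𝟏-×ʳ : J₁-never-𝟏 B → J₁-never-𝟏 (A ×ₐ B)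
J₁-never-𝟏-×ʳ never x p = never (proj₂ x) (proj₂ p)

NBCA-if-J₁-never-𝟏 : BCA A → J₁-never-𝟏 A → NBCA A
NBCA-if-J₁-never-𝟏 bca never = bca , λ x _ p → ⊥-elim (never x p)

NBCA-×𝟚 : BCA A → NBCA (A ×ₐ 𝟚)
NBCA-×𝟚 {A = A} bca =
  NBCA-if-J₁-never-𝟏 (BCA-× bca BCA-𝟚) (J₁-never-𝟏-×ʳ {B = 𝟚} {A = A} J₁-never-𝟏-𝟚)

NBCA-𝟚 : NBCA {ℓ} 𝟚
NBCA-𝟚 = NBCA-if-J₁-never-𝟏 BCA-𝟚 J₁-never-𝟏-𝟚

-- The extra factor C keeps the second coordinate visible even when I is empty.
embedding-×-Π : {A : I → Alg ℓ} → Embedding S (Π-Alg I A) →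
  Embedding (S ×ₐ C) (Π-Alg (I ⊎ ⊤ {ℓ}) [ (λ i → A i ×ₐ C) , const C ])
embedding-×-Π {C = C} {A = A} (e , e-inj) =
  Π-hom {A = [ (λ i → A i ×ₐ C) , const C ]}
        [ (λ i → ⟨ π {A = A} i ∘ₕ e ∘ₕ proj₁ₕ , proj₂ₕ ⟩ₕ) , const proj₂ₕ ] ,
  λ x y p → e-inj _ _ (proj₁ ∘ p ∘ inj₁) , p (inj₂ tt)

proj₁-epi : Epi S B → Epi (S ×ₐ C) B
proj₁-epi {C = C} (f , f-surj) = f ∘ₕ proj₁ₕ , λ b → (proj₁ (f-surj b) , 𝟎 C) , proj₂ (f-surj b)

𝕍-mono : {K L : Alg ℓ → Set _} → (∀ {A} → K A → L A) → 𝕍 K B → 𝕍 L B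
𝕍-mono K⊆L (I , A , K-A , rest) = I , A , K⊆L ∘ K-A , rest

𝕍-BCA⊆𝕍-NBCA : 𝕍 BCA B → 𝕍 NBCA B
𝕍-BCA⊆𝕍-NBCA {ℓ} (I , A , bca , S , e , f) =
  (I ⊎ ⊤) , A×𝟚 , nbca , (S ×ₐ 𝟚) , embedding-×-Π e , proj₁-epi f
  where
  A×𝟚 : I ⊎ ⊤ {ℓ} → Alg ℓ
  A×𝟚 = [ (λ i → A i ×ₐ 𝟚) , const 𝟚 ]
  nbca : ∀ j → NBCA (A×𝟚 j)
  nbca = [ NBCA-×𝟚 ∘ bca , const NBCA-𝟚 ]

corollary3p11 : {ℓ : Level} (B : Alg ℓ) →
    (𝕍 NBCA B → 𝕍 BCA B) × (𝕍 BCA B → 𝕍 NBCA B)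
corollary3p11 B = 𝕍-mono {K = NBCA} proj₁ , 𝕍-BCA⊆𝕍-NBCA
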